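{- If $k$ and $n\geq k$ are positive integers, then $c_k(n)\leq 2^{2(n-k)}$. In particular, $c_k(n)\leq 2^n$ for $n\leq 2k$.
   Context: A pair $(\mathcal{A},\mathcal{B})$ of families of subsets of a finite set $S$ is called cancellative if (i) whenever $A,A'\in\mathcal{A}$ and $B\in\mathcal{B}$ satisfy $A\cup B=A'\cup B$, then $A=A'$; and (ii) whenever $A\in\mathcal{A}$ and $B,B'\in\mathcal{B}$ satisfy $A\cup B=A\cup B'$, then $B=B'$. Such a pair is called $k$-uniform if $|A|=|B|=k$ for all $A\in\mathcal{A}$, $B\in\mathcal{B}$. $c_k(n)$ denotes the maximum of $|\mathcal{A}||\mathcal{B}|$ over all $k$-uniform cancellative pairs over an $n$-element set. -}

module Defs where

open import Data.Nat using (ℕ)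
open import Data.Fin.Subset using (Subset; _∪_; ∣_∣)
open import Data.List using (List)
open import Data.List.Membership.Propositional using (_∈_)
open import Data.List.Relation.Unary.All using (All)
open import Data.List.Relation.Unary.Unique.Propositional using (Unique)
open import Relation.Binary.PropositionalEquality using (_≡_)
open import Data.Product using (_×_)

-- A family of subsets of the n-element set Fin n: a duplicate-free list
-- of subsets (so its size is the length of the list).
record Family (n : ℕ) : Set where
  constructor family
  field
    members : List (Subset n)
    distinct : Unique members
open Family public

Cancellative : {n : ℕ} → List (Subset n) → List (Subset n) → Set
Cancellative 𝒜 ℬ =
  (∀ {A A′ B} → A ∈ 𝒜 → A′ ∈ 𝒜 → B ∈ ℬ → A ∪ B ≡ A′ ∪ B → A ≡ A′) ×
  (∀ {A B B′} → A ∈ 𝒜 → B ∈ ℬ → B′ ∈ ℬ → A ∪ B ≡ A ∪ B′ → B ≡ B′)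

Uniform : {n : ℕ} → ℕ → List (Subset n) → Set
Uniform k 𝒜 = All (λ A → ∣ A ∣ ≡ k) 𝒜

-- Fix B ∈ ℬ. By cancellativity A ↦ A ∪ B is injective on 𝒜, and its values are
-- supersets of B; since |B| = k there are only 2^(n-k) of those, so |𝒜| ≤ 2^(n-k).
-- Symmetrically |ℬ| ≤ 2^(n-k), and multiplying gives the bound; when n ≤ 2k we
-- have 2(n-k) ≤ n.
module Submission where

open import Defs
open import Data.Nat using (ℕ; suc; _+_; _*_; _^_; _∸_; _≤_; _≥_; NonZero; z≤n)
open import Data.Nat.Properties
open import Data.Bool as Bool using ()
open import Data.List using (List; []; _∷_; length; map)
open import Data.List.Properties using (length-map)
open import Data.List.Membership.Propositional using (_∈_)
open import Data.List.Relation.Unary.Any using (here; there)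
open import Data.List.Relation.Unary.All as All using (All; []; _∷_)
import Data.List.Relation.Unary.All.Properties as All
open import Data.List.Relation.Unary.Unique.Propositional using (Unique; []; _∷_)
open import Data.Vec using ([]; _∷_; here)
open import Data.Fin.Subset using (Subset; Side; inside; outside; _∪_; ∁; ∣_∣; _⊆_)
open import Data.Fin.Subset.Properties using (drop-∷-⊆; p⊆p∪q; q⊆p∪q; ∣∁p∣≡n∸∣p∣)
open import Data.Product using (_×_; _,_)
open import Relation.Nullary using (¬_; yes; no; contradiction)
open import Relation.Binary.PropositionalEquality using (_≡_; refl; sym; trans; cong; subst; subst₂)

private
  variable
    X Y : Set
    n : ℕ

InjectiveOn : (X → Y) → List X → Set
InjectiveOn f xs = ∀ {x y} → x ∈ xs → y ∈ xs → f x ≡ f y → x ≡ y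

map⁺-injectiveOn : {f : X → Y} {xs : List X} → InjectiveOn f xs → Unique xs → Unique (map f xs)
map⁺-injectiveOn {xs = []} _ [] = []
map⁺-injectiveOn {f = f} {xs = x ∷ xs} inj (x∉xs ∷ xs!) =
  All.map⁺ (All.tabulate fx∉fxs) ∷ map⁺-injectiveOn (λ p q → inj (there p) (there q)) xs!
  where
  fx∉fxs : ∀ {y} → y ∈ xs → ¬ f x ≡ f y
  fx∉fxs y∈xs fx≡fy = All.lookup x∉xs y∈xs (inj (here refl) (there y∈xs) fx≡fy)

tailsWith : Side → List (Subset (suc n)) → List (Subset n)
tailsWith s [] = []
tailsWith s ((t ∷ p) ∷ ps) with t Bool.≟ s
... | yes _ = p ∷ tailsWith s ps
... | no _ = tailsWith s ps

∈-tailsWith⁻ : ∀ s (ps : List (Subset (suc n))) {q} → q ∈ tailsWith s ps → (s ∷ q) ∈ ps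
∈-tailsWith⁻ s ((t ∷ p) ∷ ps) q∈ with t Bool.≟ s | q∈
... | yes refl | here refl = here refl
... | yes refl | there q∈′ = there (∈-tailsWith⁻ s ps q∈′)
... | no _ | q∈′ = there (∈-tailsWith⁻ s ps q∈′)

tailsWith-unique : ∀ s {ps : List (Subset (suc n))} → Unique ps → Unique (tailsWith s ps)
tailsWith-unique s {[]} [] = []
tailsWith-unique s {(t ∷ p) ∷ ps} (p∉ps ∷ ps!) with t Bool.≟ s
... | yes refl = All.tabulate (λ q∈ p≡q → All.lookup p∉ps (∈-tailsWith⁻ s ps q∈) (cong (s ∷_) p≡q))
                 ∷ tailsWith-unique s ps!
... | no _ = tailsWith-unique s ps!

length-tailsWith : (ps : List (Subset (suc n))) →
  length ps ≡ length (tailsWith inside ps) + length (tailsWith outside ps)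
length-tailsWith [] = refl
length-tailsWith ((inside ∷ p) ∷ ps) = cong suc (length-tailsWith ps)
length-tailsWith ((outside ∷ p) ∷ ps) =
  trans (cong suc (length-tailsWith ps)) (sym (+-suc (length (tailsWith inside ps)) _))

tailsWith-supersets : ∀ s t {M : Subset n} {ps} → All (t ∷ M ⊆_) ps → All (M ⊆_) (tailsWith s ps)
tailsWith-supersets s t {ps = ps} M⊆ps =
  All.tabulate (λ q∈ → drop-∷-⊆ (All.lookup M⊆ps (∈-tailsWith⁻ s ps q∈)))

length-tailsWith-outside≡0 : {M : Subset n} {ps : List (Subset (suc n))} →
  All (inside ∷ M ⊆_) ps → length (tailsWith outside ps) ≡ 0
length-tailsWith-outside≡0 {ps = ps} M⊆ps with tailsWith outside ps in eq
... | [] = refl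
... | q ∷ _ = contradiction (All.lookup M⊆ps (∈-tailsWith⁻ outside ps q∈) here) λ ()
  where
  q∈ : q ∈ tailsWith outside ps
  q∈ = subst (q ∈_) (sym eq) (here refl)

length-supersets≤ : (M : Subset n) {ps : List (Subset n)} →
  Unique ps → All (M ⊆_) ps → length ps ≤ 2 ^ ∣ ∁ M ∣
length-supersets≤ [] {[]} _ _ = z≤n
length-supersets≤ [] {[] ∷ []} _ _ = ≤-refl
length-supersets≤ [] {[] ∷ [] ∷ _} ((p≢p ∷ _) ∷ _) _ = contradiction refl p≢p
length-supersets≤ (inside ∷ M) {ps} ps! M⊆ps = begin
  length ps
    ≡⟨ length-tailsWith ps ⟩
  length (tailsWith inside ps) + length (tailsWith outside ps)
    ≡⟨ cong (length (tailsWith inside ps) +_) (length-tailsWith-outside≡0 M⊆ps) ⟩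
  length (tailsWith inside ps) + 0
    ≡⟨ +-identityʳ _ ⟩
  length (tailsWith inside ps)
    ≤⟨ bound inside ⟩
  2 ^ ∣ ∁ M ∣ ∎
  where
  open ≤-Reasoning
  bound : ∀ s → length (tailsWith s ps) ≤ 2 ^ ∣ ∁ M ∣
  bound s = length-supersets≤ M (tailsWith-unique s ps!) (tailsWith-supersets s inside M⊆ps)
length-supersets≤ (outside ∷ M) {ps} ps! M⊆ps = begin
  length ps
    ≡⟨ length-tailsWith ps ⟩
  length (tailsWith inside ps) + length (tailsWith outside ps)
    ≤⟨ +-mono-≤ (bound inside) (bound outside) ⟩
  2 ^ ∣ ∁ M ∣ + 2 ^ ∣ ∁ M ∣
    ≡⟨ cong (2 ^ ∣ ∁ M ∣ +_) (sym (+-identityʳ _)) ⟩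
  2 ^ suc ∣ ∁ M ∣ ∎
  where
  open ≤-Reasoning
  bound : ∀ s → length (tailsWith s ps) ≤ 2 ^ ∣ ∁ M ∣
  bound s = length-supersets≤ M (tailsWith-unique s ps!) (tailsWith-supersets s outside M⊆ps)

length-injectiveOn-supersets≤ : (M : Subset n) (f : Subset n → Subset n) {ps : List (Subset n)} →
  (∀ p → M ⊆ f p) → InjectiveOn f ps → Unique ps → length ps ≤ 2 ^ (n ∸ ∣ M ∣)
length-injectiveOn-supersets≤ M f {ps} M⊆f inj ps! =
  subst₂ _≤_ (length-map f ps) (cong (2 ^_) (∣∁p∣≡n∸∣p∣ M))
    (length-supersets≤ M (map⁺-injectiveOn inj ps!) (All.map⁺ (All.universal M⊆f ps)))

cancellative⇒lengthˡ≤ : ∀ {k} {𝒜 ℬ : List (Subset n)} {B} → Cancellative 𝒜 ℬ →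
  Unique 𝒜 → Uniform k ℬ → B ∈ ℬ → length 𝒜 ≤ 2 ^ (n ∸ k)
cancellative⇒lengthˡ≤ {n} {𝒜 = 𝒜} {B = B} (cancelˡ , _) 𝒜! uℬ B∈ℬ =
  subst (λ j → length 𝒜 ≤ 2 ^ (n ∸ j)) (All.lookup uℬ B∈ℬ)
    (length-injectiveOn-supersets≤ B (_∪ B) (λ A → q⊆p∪q A B) (λ A∈ A′∈ → cancelˡ A∈ A′∈ B∈ℬ) 𝒜!)

cancellative⇒lengthʳ≤ : ∀ {k} {𝒜 ℬ : List (Subset n)} {A} → Cancellative 𝒜 ℬ →
  Unique ℬ → Uniform k 𝒜 → A ∈ 𝒜 → length ℬ ≤ 2 ^ (n ∸ k)
cancellative⇒lengthʳ≤ {n} {ℬ = ℬ} {A = A} (_ , cancelʳ) ℬ! u𝒜 A∈𝒜 =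
  subst (λ j → length ℬ ≤ 2 ^ (n ∸ j)) (All.lookup u𝒜 A∈𝒜)
    (length-injectiveOn-supersets≤ A (A ∪_) (p⊆p∪q {p = A}) (cancelʳ A∈𝒜) ℬ!)

length*length≤ : {xs : List X} {ys : List Y} {c : ℕ} →
  (∀ {y} → y ∈ ys → length xs ≤ c) → (∀ {x} → x ∈ xs → length ys ≤ c) →
  length xs * length ys ≤ c * c
length*length≤ {xs = []} _ _ = z≤n
length*length≤ {xs = x ∷ xs} {ys = []} {c} _ _ =
  subst (_≤ c * c) (sym (*-zeroʳ (length (x ∷ xs)))) z≤n
length*length≤ {xs = _ ∷ _} {ys = _ ∷ _} xs≤ ys≤ = *-mono-≤ (xs≤ (here refl)) (ys≤ (here refl))

2*[n∸k]≤n : ∀ {k n} → k ≤ n → n ≤ 2 * k → 2 * (n ∸ k) ≤ n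
2*[n∸k]≤n {k} {n} k≤n n≤2k = begin
  2 * (n ∸ k)         ≡⟨ cong (n ∸ k +_) (+-identityʳ (n ∸ k)) ⟩
  (n ∸ k) + (n ∸ k)   ≤⟨ +-monoʳ-≤ (n ∸ k) (m≤n+o⇒m∸n≤o n k n≤k+k) ⟩
  (n ∸ k) + k         ≡⟨ m∸n+n≡m k≤n ⟩
  n                   ∎
  where
  open ≤-Reasoning
  n≤k+k : n ≤ k + k
  n≤k+k = subst (n ≤_) (cong (k +_) (+-identityʳ k)) n≤2k

lemma3 : (k n : ℕ) → .{{NonZero k}} → n ≥ k →
    (𝒜 ℬ : Family n) →
    Uniform k (members 𝒜) → Uniform k (members ℬ) →
    Cancellative (members 𝒜) (members ℬ) →
    (length (members 𝒜) * length (members ℬ) ≤ 2 ^ (2 * (n ∸ k)))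
      × (n ≤ 2 * k → length (members 𝒜) * length (members ℬ) ≤ 2 ^ n)
lemma3 k n k≤n 𝒜 ℬ u𝒜 uℬ cancel = bound , λ n≤2k → ≤-trans bound (^-monoʳ-≤ 2 (2*[n∸k]≤n k≤n n≤2k))
  where
  open ≤-Reasoning
  bound : length (members 𝒜) * length (members ℬ) ≤ 2 ^ (2 * (n ∸ k))
  bound = begin
    length (members 𝒜) * length (members ℬ)
      ≤⟨ length*length≤ (cancellative⇒lengthˡ≤ cancel (distinct 𝒜) uℬ)
                        (cancellative⇒lengthʳ≤ cancel (distinct ℬ) u𝒜) ⟩
    2 ^ (n ∸ k) * 2 ^ (n ∸ k)   ≡⟨ ^-distribˡ-+-* 2 (n ∸ k) (n ∸ k) ⟨
    2 ^ ((n ∸ k) + (n ∸ k))     ≡⟨ cong (λ m → 2 ^ (n ∸ k + m)) (+-identityʳ (n ∸ k)) ⟨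
    2 ^ (2 * (n ∸ k))           ∎
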